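{- Let $\Delta_n$ be the $n$-dimensional simplex and $C^*_n$ the $n$-dimensional cross-polytope. Then $\Theta(\Psi(\Delta_n))=[n+1]!$ and $\Theta(\Psi(C^*_n))=[2]^n\cdot[n]!$.
   Context: For a graded poset $P$ of rank $n+1$ with minimum $\hat 0$, maximum $\hat 1$ and rank function $\rho$, and $S=\{s_1<\cdots<s_k\}\subseteq\{1,\dots,n\}$, the flag $f$-vector entry $f_S$ is the number of chains $\hat 0<x_1<\cdots<x_k<\hat 1$ with $\rho(x_i)=s_i$. The $\mathbf{a}\mathbf{b}$-index is $\Psi(P)=\sum_{S\subseteq\{1,\dots,n\}} f_S\, v_S$, where $v_S=v_1\cdots v_n$ with $v_i=\mathbf{b}$ if $i\in S$ and $v_i=\mathbf{a}-\mathbf{b}$ if $i\notin S$; this is an element of the ring $\mathbb{Z}\langle \mathbf{a},\mathbf{b}\rangle$ of polynomials in non-commuting variables. For a polytope $V$, $\Psi(V)$ denotes the $\mathbf{a}\mathbf{b}$-index of its face lattice. The Major MacMahon map $\Theta:\mathbb{Z}\langle \mathbf{a},\mathbf{b}\rangle\to\mathbb{Z}[q]$ is the linear map with $\Theta(u_1\cdots u_n)=\prod_{i:\,u_i=\mathbf{b}}q^i$ on monomials. $[k]=1+q+\cdots+q^{k-1}$ and $[k]!=[k][k-1]\cdots[1]$. -}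

module Defs where

open import Data.Bool using (Bool; true; false; if_then_else_; _∧_; _∨_; not)
open import Data.Nat using (ℕ; zero; suc; _≡ᵇ_)
open import Data.Integer using (ℤ; +_; -_; _+_; _*_)
open import Data.List using (List; []; _∷_; _++_; map; concatMap; foldr; replicate; filter)
open import Data.Vec using (Vec; []; _∷_)
open import Data.Maybe using (Maybe; just; nothing)
open import Data.Product using (_×_; _,_)

-- Non-commutative polynomials Z<a,b> as formal sums of monomials

data AB : Set where
  𝐚 𝐛 : AB

Word : Set
Word = List AB

NCPoly : Set
NCPoly = List (ℤ × Word)

ncOne : NCPoly
ncOne = (+ 1 , []) ∷ []

ncVar : AB → NCPoly
ncVar x = (+ 1 , x ∷ []) ∷ []

ncScale : ℤ → NCPoly → NCPoly
ncScale c = map (λ { (d , w) → (c * d , w) })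

ncAdd : NCPoly → NCPoly → NCPoly
ncAdd = _++_

ncMul : NCPoly → NCPoly → NCPoly
ncMul p q = concatMap (λ { (c , u) → map (λ { (d , v) → (c * d , u ++ v) }) q }) p

aMinusB : NCPoly
aMinusB = (+ 1 , 𝐚 ∷ []) ∷ (- (+ 1) , 𝐛 ∷ []) ∷ []

-- Polynomials in Z[q] as coefficient lists (index = degree)

Poly : Set
Poly = List ℤ

coeff : Poly → ℕ → ℤ
coeff []       _       = + 0
coeff (c ∷ p)  zero    = c
coeff (c ∷ p)  (suc k) = coeff p k

pAdd : Poly → Poly → Poly
pAdd []       q        = q
pAdd p        []       = p
pAdd (c ∷ p)  (d ∷ q)  = (c + d) ∷ pAdd p q

pScale : ℤ → Poly → Poly
pScale c = map (c *_)

pMul : Poly → Poly → Poly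
pMul []      q = []
pMul (c ∷ p) q = pAdd (pScale c q) (+ 0 ∷ pMul p q)

pOne : Poly
pOne = + 1 ∷ []

pMonomial : ℤ → ℕ → Poly
pMonomial c k = replicate k (+ 0) ++ (c ∷ [])

qInt : ℕ → Poly
qInt k = replicate k (+ 1)

qFact : ℕ → Poly
qFact zero    = pOne
qFact (suc k) = pMul (qInt (suc k)) (qFact k)

pPow : Poly → ℕ → Poly
pPow p zero    = pOne
pPow p (suc k) = pMul p (pPow p k)

-- Major MacMahon map Θ : Z<a,b> → Z[q],
-- Θ(u_1 ... u_n) = prod_{i : u_i = b} q^i  (positions 1-indexed), extended linearly

majFrom : ℕ → Word → ℕ
majFrom i []        = 0
majFrom i (𝐚 ∷ w)   = majFrom (suc i) w
majFrom i (𝐛 ∷ w)   = i Data.Nat.+ majFrom (suc i) w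

maj : Word → ℕ
maj = majFrom 1

Θ : NCPoly → Poly
Θ = foldr (λ { (c , w) acc → pAdd (pMonomial c (maj w)) acc }) []

record FinGradedPoset : Set₁ where
  field
    Elem  : Set
    elems : List Elem          -- complete list of the elements (each once)
    _<ᵇ_  : Elem → Elem → Bool -- strict order relation
    rank  : Elem → ℕ
    bot   : Elem
    top   : Elem

open FinGradedPoset

count : List ℕ → ℕ
count = foldr Data.Nat._+_ 0

chainsFrom : (P : FinGradedPoset) → Elem P → List ℕ → ℕ
chainsFrom P x []       = if _<ᵇ_ P x (top P) then 1 else 0
chainsFrom P x (s ∷ ss) =
  count (map (λ y → if (rank P y ≡ᵇ s) ∧ _<ᵇ_ P x y then chainsFrom P y ss else 0)
             (elems P))

-- flag f-vector entry f_S, S given as increasing list of ranks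
flagF : (P : FinGradedPoset) → List ℕ → ℕ
flagF P S = chainsFrom P (bot P) S

-- subsets of {1..n} as characteristic vectors (index i ↦ element i+1)
allBoolVecs : (n : ℕ) → List (Vec Bool n)
allBoolVecs zero    = [] ∷ []
allBoolVecs (suc n) = concatMap (λ v → (true ∷ v) ∷ (false ∷ v) ∷ []) (allBoolVecs n)

setFrom : {n : ℕ} → ℕ → Vec Bool n → List ℕ
setFrom i []            = []
setFrom i (true  ∷ v)   = i ∷ setFrom (suc i) v
setFrom i (false ∷ v)   = setFrom (suc i) v

toSet : {n : ℕ} → Vec Bool n → List ℕ
toSet = setFrom 1

vS : {n : ℕ} → Vec Bool n → NCPoly
vS []          = ncOne
vS (true  ∷ v) = ncMul (ncVar 𝐛) (vS v)
vS (false ∷ v) = ncMul aMinusB (vS v)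

-- ab-index of a graded poset of rank n+1
Ψ : (n : ℕ) → FinGradedPoset → NCPoly
Ψ n P = concatMap (λ S → ncScale (+ flagF P (toSet S)) (vS S)) (allBoolVecs n)

-- Face lattice of the n-simplex Δ_n: all subsets of its n+1 vertices,
-- ordered by strict inclusion, rank = cardinality (= dim + 1).

countTrue : {m : ℕ} → Vec Bool m → ℕ
countTrue []          = 0
countTrue (true  ∷ v) = suc (countTrue v)
countTrue (false ∷ v) = countTrue v

subsetᵇ : {m : ℕ} → Vec Bool m → Vec Bool m → Bool
subsetᵇ []      []      = true
subsetᵇ (x ∷ u) (y ∷ v) = (not x ∨ y) ∧ subsetᵇ u v

eqBoolVec : {m : ℕ} → Vec Bool m → Vec Bool m → Bool
eqBoolVec []      []      = true
eqBoolVec (x ∷ u) (y ∷ v) = ((x ∧ y) ∨ (not x ∧ not y)) ∧ eqBoolVec u v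

constVec : {m : ℕ} → Bool → Vec Bool m
constVec {zero}  b = []
constVec {suc m} b = b ∷ constVec b

simplexFaceLattice : ℕ → FinGradedPoset
simplexFaceLattice n = record
  { Elem  = Vec Bool (suc n)
  ; elems = allBoolVecs (suc n)
  ; _<ᵇ_  = λ x y → subsetᵇ x y ∧ not (eqBoolVec x y)
  ; rank  = countTrue
  ; bot   = constVec false
  ; top   = constVec true
  }

-- Face lattice of the n-dimensional cross-polytope C*_n = conv{±e_1,...,±e_n}.
-- Proper faces (incl. the empty face) = sets of vertices with no antipodal pair,
-- encoded as sign vectors in {0,+,-}^n; the polytope itself is `nothing`.

data Sign : Set where
  s0 s+ s- : Sign

allSignVecs : (n : ℕ) → List (Vec Sign n)
allSignVecs zero    = [] ∷ []
allSignVecs (suc n) = concatMap (λ v → (s0 ∷ v) ∷ (s+ ∷ v) ∷ (s- ∷ v) ∷ []) (allSignVecs n)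

signLeᵇ : Sign → Sign → Bool
signLeᵇ s0 _  = true
signLeᵇ s+ s+ = true
signLeᵇ s- s- = true
signLeᵇ _  _  = false

signEqᵇ : Sign → Sign → Bool
signEqᵇ x y = signLeᵇ x y ∧ signLeᵇ y x

signVecLeᵇ : {m : ℕ} → Vec Sign m → Vec Sign m → Bool
signVecLeᵇ []      []      = true
signVecLeᵇ (x ∷ u) (y ∷ v) = signLeᵇ x y ∧ signVecLeᵇ u v

signVecEqᵇ : {m : ℕ} → Vec Sign m → Vec Sign m → Bool
signVecEqᵇ []      []      = true
signVecEqᵇ (x ∷ u) (y ∷ v) = signEqᵇ x y ∧ signVecEqᵇ u v

support : {m : ℕ} → Vec Sign m → ℕ
support []        = 0
support (s0 ∷ v)  = support v
support (s+ ∷ v)  = suc (support v)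
support (s- ∷ v)  = suc (support v)

zeroSigns : {m : ℕ} → Vec Sign m
zeroSigns {zero}  = []
zeroSigns {suc m} = s0 ∷ zeroSigns

crossLtᵇ : {m : ℕ} → Maybe (Vec Sign m) → Maybe (Vec Sign m) → Bool
crossLtᵇ (just u) (just v) = signVecLeᵇ u v ∧ not (signVecEqᵇ u v)
crossLtᵇ (just u) nothing  = true
crossLtᵇ nothing  _        = false

crossRank : {m : ℕ} → Maybe (Vec Sign m) → ℕ
crossRank {m} nothing  = suc m
crossRank     (just u) = support u

crossFaceLattice : ℕ → FinGradedPoset
crossFaceLattice n = record
  { Elem  = Maybe (Vec Sign n)
  ; elems = nothing ∷ map just (allSignVecs n)
  ; _<ᵇ_  = crossLtᵇ
  ; rank  = crossRank
  ; bot   = just zeroSigns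
  ; top   = nothing
  }

{-# OPTIONS --safe #-}
module Submission where

-- Write H_k(z) for Θ applied to the ab-index of the interval [0̂, z], keeping only the rank
-- sets S ⊆ {1, …, k}. Splitting on whether k + 1 ∈ S gives
--   H_{k+1}(z) = q^{k+1} Σ_{y < z, ρ(y) = k+1} H_k(y) + (1 − q^{k+1}) H_k(z).
-- If all these y have Boolean lower intervals then, inductively, H_k(y) = [k+1]!, and since
-- 1 − q^{k+1} = (1 − q)[k+1] the recursion is solved by
--   H_k(z) = [k]! Σ_{j ≤ k} N_j q^j (1 − q)^{k−j},   N_j = #{y < z : ρ(y) = j}.
-- Below an element of rank t of a Boolean lattice N_j = C(t, j), and the sum at k = t − 1 is [t];
-- for the simplex this gives [n+1]!. The proper faces of the cross-polytope are simplices and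
-- below its top N_j = 2^j C(n, j), so the sum at k = n is (1 − q + 2q)^n = [2]^n.

open import Defs
open import Data.Nat using (ℕ; suc)
open import Data.Integer using (ℤ)
open import Data.Product using (_×_; _,_)
open import Relation.Binary.PropositionalEquality using (_≡_)

open import Algebra.Bundles using (CommutativeRing)
import Algebra.Consequences.Setoid as Consequences
open import Algebra.Structures using (IsCommutativeRing)
open import Data.Bool using (Bool; true; false; if_then_else_; _∧_; not; T)
open import Data.Bool.Properties using (T-≡; ∧-zeroʳ; ∧-identityʳ)
open import Data.Empty using (⊥-elim)
open import Data.Integer as ℤ using (+_)
import Data.Integer.Properties as ℤₚ
open import Data.List using (List; []; _∷_; _++_; map; concatMap)
import Data.List.Properties as Listₚ
open import Data.Maybe using (Maybe; just; nothing; is-just)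
open import Data.Nat as ℕ using (zero; _≡ᵇ_; _<_; _≤_)
open import Data.Nat.Combinatorics using (_C_; nCk+nC[k+1]≡[n+1]C[k+1]; k>n⇒nCk≡0)
open import Data.Nat.ListAction.Properties using (sum-++)
import Data.Nat.Properties as ℕₚ
open import Algebra.Properties.CommutativeSemigroup ℕₚ.+-commutativeSemigroup
  using () renaming (interchange to +-interchange)
import Data.Nat.Tactic.RingSolver as ℕ-Solver
open import Data.Unit using (⊤; tt)
open import Data.Vec using (Vec; _∷ʳ_) renaming ([] to []ᵥ; _∷_ to _∷ᵥ_)
open import Function.Bundles using (Equivalence)
open import Level using (0ℓ)
open import Relation.Binary.Bundles using (Setoid)
open import Relation.Binary.PropositionalEquality using (refl; sym; trans; cong; cong₂; module ≡-Reasoning)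
open import Relation.Binary.Structures using (IsEquivalence)
open import Relation.Nullary using (yes)
import Tactic.RingSolver.Core.AlmostCommutativeRing as ACR
open import Tactic.RingSolver using (solve-∀)

private variable
  A B : Set

-- The ring ℤ[q]

-- Coefficient lists are compared coefficientwise, i.e. up to trailing zeros.
infix 4 _≈_
record _≈_ (p q : Poly) : Set where
  constructor coeffwise
  field coeff-≡ : ∀ k → coeff p k ≡ coeff q k
open _≈_ public

≈-refl : ∀ {p} → p ≈ p
≈-refl = coeffwise λ _ → refl

≈-sym : ∀ {p q} → p ≈ q → q ≈ p
≈-sym p≈q = coeffwise λ k → sym (coeff-≡ p≈q k)

≈-trans : ∀ {p q r} → p ≈ q → q ≈ r → p ≈ r
≈-trans p≈q q≈r = coeffwise λ k → trans (coeff-≡ p≈q k) (coeff-≡ q≈r k)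

≈-reflexive : ∀ {p q} → p ≡ q → p ≈ q
≈-reflexive refl = ≈-refl

≈-isEquivalence : IsEquivalence _≈_
≈-isEquivalence = record { refl = ≈-refl ; sym = ≈-sym ; trans = ≈-trans }

≈-setoid : Setoid 0ℓ 0ℓ
≈-setoid = record { isEquivalence = ≈-isEquivalence }

∷-cong : ∀ {c d p q} → c ≡ d → p ≈ q → c ∷ p ≈ d ∷ q
∷-cong c≡d p≈q = coeffwise λ { zero → c≡d ; (suc k) → coeff-≡ p≈q k }

pNeg : Poly → Poly
pNeg = map (λ c → ℤ.- c)

coeff-pAdd : ∀ p q k → coeff (pAdd p q) k ≡ coeff p k ℤ.+ coeff q k
coeff-pAdd []      q       k       = sym (ℤₚ.+-identityˡ _)
coeff-pAdd (c ∷ p) []      k       = sym (ℤₚ.+-identityʳ _)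
coeff-pAdd (c ∷ p) (d ∷ q) zero    = refl
coeff-pAdd (c ∷ p) (d ∷ q) (suc k) = coeff-pAdd p q k

coeff-pScale : ∀ c p k → coeff (pScale c p) k ≡ c ℤ.* coeff p k
coeff-pScale c []      k       = sym (ℤₚ.*-zeroʳ c)
coeff-pScale c (d ∷ p) zero    = refl
coeff-pScale c (d ∷ p) (suc k) = coeff-pScale c p k

coeff-pNeg : ∀ p k → coeff (pNeg p) k ≡ ℤ.- coeff p k
coeff-pNeg []      k       = refl
coeff-pNeg (c ∷ p) zero    = refl
coeff-pNeg (c ∷ p) (suc k) = coeff-pNeg p k

module _ where
  open ≡-Reasoning

  pAdd-cong : ∀ {p p′ q q′} → p ≈ p′ → q ≈ q′ → pAdd p q ≈ pAdd p′ q′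
  pAdd-cong {p} {p′} {q} {q′} p≈p′ q≈q′ = coeffwise λ k → begin
    coeff (pAdd p q) k          ≡⟨ coeff-pAdd p q k ⟩
    coeff p k ℤ.+ coeff q k     ≡⟨ cong₂ ℤ._+_ (coeff-≡ p≈p′ k) (coeff-≡ q≈q′ k) ⟩
    coeff p′ k ℤ.+ coeff q′ k   ≡⟨ coeff-pAdd p′ q′ k ⟨
    coeff (pAdd p′ q′) k        ∎

  pAdd-assoc : ∀ p q r → pAdd (pAdd p q) r ≈ pAdd p (pAdd q r)
  pAdd-assoc p q r = coeffwise λ k → begin
    coeff (pAdd (pAdd p q) r) k                 ≡⟨ coeff-pAdd (pAdd p q) r k ⟩
    coeff (pAdd p q) k ℤ.+ coeff r k            ≡⟨ cong (ℤ._+ coeff r k) (coeff-pAdd p q k) ⟩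
    coeff p k ℤ.+ coeff q k ℤ.+ coeff r k       ≡⟨ ℤₚ.+-assoc (coeff p k) (coeff q k) (coeff r k) ⟩
    coeff p k ℤ.+ (coeff q k ℤ.+ coeff r k)     ≡⟨ cong (λ z → coeff p k ℤ.+ z) (coeff-pAdd q r k) ⟨
    coeff p k ℤ.+ coeff (pAdd q r) k            ≡⟨ coeff-pAdd p (pAdd q r) k ⟨
    coeff (pAdd p (pAdd q r)) k                 ∎

  pAdd-comm : ∀ p q → pAdd p q ≈ pAdd q p
  pAdd-comm p q = coeffwise λ k → begin
    coeff (pAdd p q) k          ≡⟨ coeff-pAdd p q k ⟩
    coeff p k ℤ.+ coeff q k     ≡⟨ ℤₚ.+-comm (coeff p k) (coeff q k) ⟩
    coeff q k ℤ.+ coeff p k     ≡⟨ coeff-pAdd q p k ⟨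
    coeff (pAdd q p) k          ∎

  pAdd-inverseˡ : ∀ p → pAdd (pNeg p) p ≈ []
  pAdd-inverseˡ p = coeffwise λ k → begin
    coeff (pAdd (pNeg p) p) k           ≡⟨ coeff-pAdd (pNeg p) p k ⟩
    coeff (pNeg p) k ℤ.+ coeff p k      ≡⟨ cong (ℤ._+ coeff p k) (coeff-pNeg p k) ⟩
    ℤ.- coeff p k ℤ.+ coeff p k         ≡⟨ ℤₚ.+-inverseˡ (coeff p k) ⟩
    + 0                                 ∎

  pNeg-cong : ∀ {p q} → p ≈ q → pNeg p ≈ pNeg q
  pNeg-cong {p} {q} p≈q = coeffwise λ k → begin
    coeff (pNeg p) k    ≡⟨ coeff-pNeg p k ⟩
    ℤ.- coeff p k       ≡⟨ cong ℤ.-_ (coeff-≡ p≈q k) ⟩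
    ℤ.- coeff q k       ≡⟨ coeff-pNeg q k ⟨
    coeff (pNeg q) k    ∎

  pScale-cong : ∀ c {p q} → p ≈ q → pScale c p ≈ pScale c q
  pScale-cong c {p} {q} p≈q = coeffwise λ k → begin
    coeff (pScale c p) k    ≡⟨ coeff-pScale c p k ⟩
    c ℤ.* coeff p k         ≡⟨ cong (c ℤ.*_) (coeff-≡ p≈q k) ⟩
    c ℤ.* coeff q k         ≡⟨ coeff-pScale c q k ⟨
    coeff (pScale c q) k    ∎

  pScale-distrib : ∀ c p q → pScale c (pAdd p q) ≈ pAdd (pScale c p) (pScale c q)
  pScale-distrib c p q = coeffwise λ k → begin
    coeff (pScale c (pAdd p q)) k                       ≡⟨ coeff-pScale c (pAdd p q) k ⟩
    c ℤ.* coeff (pAdd p q) k                            ≡⟨ cong (c ℤ.*_) (coeff-pAdd p q k) ⟩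
    c ℤ.* (coeff p k ℤ.+ coeff q k)                     ≡⟨ ℤₚ.*-distribˡ-+ c (coeff p k) (coeff q k) ⟩
    c ℤ.* coeff p k ℤ.+ c ℤ.* coeff q k                 ≡⟨ cong₂ ℤ._+_ (coeff-pScale c p k) (coeff-pScale c q k) ⟨
    coeff (pScale c p) k ℤ.+ coeff (pScale c q) k       ≡⟨ coeff-pAdd (pScale c p) (pScale c q) k ⟨
    coeff (pAdd (pScale c p) (pScale c q)) k            ∎

  pScale-assoc : ∀ c d p → pScale (c ℤ.* d) p ≈ pScale c (pScale d p)
  pScale-assoc c d p = coeffwise λ k → begin
    coeff (pScale (c ℤ.* d) p) k        ≡⟨ coeff-pScale (c ℤ.* d) p k ⟩
    c ℤ.* d ℤ.* coeff p k               ≡⟨ ℤₚ.*-assoc c d (coeff p k) ⟩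
    c ℤ.* (d ℤ.* coeff p k)             ≡⟨ cong (c ℤ.*_) (coeff-pScale d p k) ⟨
    c ℤ.* coeff (pScale d p) k          ≡⟨ coeff-pScale c (pScale d p) k ⟨
    coeff (pScale c (pScale d p)) k     ∎

  pScale-identity : ∀ p → pScale (+ 1) p ≈ p
  pScale-identity p = coeffwise λ k → trans (coeff-pScale (+ 1) p k) (ℤₚ.*-identityˡ (coeff p k))

  pMul-shiftˡ : ∀ p q → pMul (+ 0 ∷ p) q ≈ + 0 ∷ pMul p q
  pMul-shiftˡ p q = coeffwise λ k → begin
    coeff (pAdd (pScale (+ 0) q) (+ 0 ∷ pMul p q)) k               ≡⟨ coeff-pAdd (pScale (+ 0) q) _ k ⟩
    coeff (pScale (+ 0) q) k ℤ.+ coeff (+ 0 ∷ pMul p q) k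
      ≡⟨ cong (ℤ._+ coeff (+ 0 ∷ pMul p q) k) (coeff-pScale (+ 0) q k) ⟩
    + 0 ℤ.+ coeff (+ 0 ∷ pMul p q) k                               ≡⟨ ℤₚ.+-identityˡ _ ⟩
    coeff (+ 0 ∷ pMul p q) k                                       ∎

pAdd-identityʳ : ∀ p → pAdd p [] ≈ p
pAdd-identityʳ p = coeffwise λ k → trans (coeff-pAdd p [] k) (ℤₚ.+-identityʳ (coeff p k))

open Consequences ≈-setoid using (comm∧assoc⇒middleFour; comm∧invˡ⇒invʳ; comm∧distrˡ⇒distrʳ)

pAdd-interchange : ∀ p q r s → pAdd (pAdd p q) (pAdd r s) ≈ pAdd (pAdd p r) (pAdd q s)
pAdd-interchange = comm∧assoc⇒middleFour pAdd-cong pAdd-comm pAdd-assoc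

-- pMul recurses on its left factor: the right-hand laws are proved directly, the left-hand
-- ones then follow from commutativity.
pMul-congʳ : ∀ p {q q′} → q ≈ q′ → pMul p q ≈ pMul p q′
pMul-congʳ []      q≈q′ = ≈-refl
pMul-congʳ (c ∷ p) q≈q′ = pAdd-cong (pScale-cong c q≈q′) (∷-cong refl (pMul-congʳ p q≈q′))

pMul-distribˡ : ∀ p q r → pMul p (pAdd q r) ≈ pAdd (pMul p q) (pMul p r)
pMul-distribˡ []      q r = ≈-refl
pMul-distribˡ (c ∷ p) q r = ≈-trans
  (pAdd-cong (pScale-distrib c q r) (∷-cong refl (pMul-distribˡ p q r)))
  (pAdd-interchange (pScale c q) (pScale c r) (+ 0 ∷ pMul p q) (+ 0 ∷ pMul p r))

pMul-zeroʳ : ∀ p → pMul p [] ≈ []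
pMul-zeroʳ []      = ≈-refl
pMul-zeroʳ (c ∷ p) = coeffwise λ { zero → refl ; (suc k) → coeff-≡ (pMul-zeroʳ p) k }

pMul-shiftʳ : ∀ p q → pMul p (+ 0 ∷ q) ≈ + 0 ∷ pMul p q
pMul-shiftʳ []      q = coeffwise λ { zero → refl ; (suc k) → refl }
pMul-shiftʳ (c ∷ p) q =
  ∷-cong (trans (ℤₚ.+-identityʳ _) (ℤₚ.*-zeroʳ c)) (pAdd-cong (≈-refl {pScale c q}) (pMul-shiftʳ p q))

pMul-constʳ : ∀ p d → pMul p (d ∷ []) ≈ pScale d p
pMul-constʳ []      d = ≈-refl
pMul-constʳ (c ∷ p) d = ∷-cong (trans (ℤₚ.+-identityʳ _) (ℤₚ.*-comm c d)) (pMul-constʳ p d)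

∷-split : ∀ c p → c ∷ p ≈ pAdd (c ∷ []) (+ 0 ∷ p)
∷-split c p = ∷-cong (sym (ℤₚ.+-identityʳ c)) ≈-refl

pMul-comm : ∀ p q → pMul p q ≈ pMul q p
pMul-comm []      q = ≈-sym (pMul-zeroʳ q)
pMul-comm (c ∷ p) q = ≈-sym (begin
  pMul q (c ∷ p)                          ≈⟨ pMul-congʳ q (∷-split c p) ⟩
  pMul q (pAdd (c ∷ []) (+ 0 ∷ p))        ≈⟨ pMul-distribˡ q (c ∷ []) (+ 0 ∷ p) ⟩
  pAdd (pMul q (c ∷ [])) (pMul q (+ 0 ∷ p)) ≈⟨ pAdd-cong (pMul-constʳ q c) (pMul-shiftʳ q p) ⟩
  pAdd (pScale c q) (+ 0 ∷ pMul q p)      ≈⟨ pAdd-cong (≈-refl {pScale c q}) (∷-cong refl (pMul-comm q p)) ⟩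
  pMul (c ∷ p) q                          ∎)
  where open import Relation.Binary.Reasoning.Setoid ≈-setoid

pMul-congˡ : ∀ {p p′} q → p ≈ p′ → pMul p q ≈ pMul p′ q
pMul-congˡ {p} {p′} q p≈p′ = ≈-trans (pMul-comm p q) (≈-trans (pMul-congʳ q p≈p′) (pMul-comm q p′))

pMul-distribʳ : ∀ r p q → pMul (pAdd p q) r ≈ pAdd (pMul p r) (pMul q r)
pMul-distribʳ = comm∧distrˡ⇒distrʳ pAdd-cong pMul-comm pMul-distribˡ

pScale-pMul : ∀ c p q → pMul (pScale c p) q ≈ pScale c (pMul p q)
pScale-pMul c []      q = ≈-refl
pScale-pMul c (d ∷ p) q = ≈-sym (≈-trans
  (pScale-distrib c (pScale d q) (+ 0 ∷ pMul p q))
  (pAdd-cong (≈-sym (pScale-assoc c d q)) (∷-cong (ℤₚ.*-zeroʳ c) (≈-sym (pScale-pMul c p q)))))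

pMul-assoc : ∀ p q r → pMul (pMul p q) r ≈ pMul p (pMul q r)
pMul-assoc []      q r = ≈-refl
pMul-assoc (c ∷ p) q r = ≈-trans
  (pMul-distribʳ r (pScale c q) (+ 0 ∷ pMul p q))
  (pAdd-cong (pScale-pMul c q r) (≈-trans (pMul-shiftˡ (pMul p q) r) (∷-cong refl (pMul-assoc p q r))))

pMul-identityˡ : ∀ p → pMul pOne p ≈ p
pMul-identityˡ p = ≈-trans (pAdd-cong (pScale-identity p) (coeffwise λ { zero → refl ; (suc k) → refl }))
                           (pAdd-identityʳ p)

ℤ[q]-isCommutativeRing : IsCommutativeRing _≈_ pAdd pMul pNeg [] pOne
ℤ[q]-isCommutativeRing = record
  { isRing = record
    { +-isAbelianGroup = record
      { isGroup = record
        { isMonoid = record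
          { isSemigroup = record
            { isMagma = record { isEquivalence = ≈-isEquivalence ; ∙-cong = pAdd-cong }
            ; assoc = pAdd-assoc }
          ; identity = (λ _ → ≈-refl) , pAdd-identityʳ }
        ; inverse = pAdd-inverseˡ , comm∧invˡ⇒invʳ pAdd-comm pAdd-inverseˡ
        ; ⁻¹-cong = pNeg-cong }
      ; comm = pAdd-comm }
    ; *-cong = λ {p} {p′} {q} p≈p′ q≈q′ → ≈-trans (pMul-congˡ q p≈p′) (pMul-congʳ p′ q≈q′)
    ; *-assoc = pMul-assoc
    ; *-identity = pMul-identityˡ , λ p → ≈-trans (pMul-comm p pOne) (pMul-identityˡ p)
    ; distrib = pMul-distribˡ , pMul-distribʳ }
  ; *-comm = pMul-comm }

ℤ[q] : CommutativeRing 0ℓ 0ℓ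
ℤ[q] = record { isCommutativeRing = ℤ[q]-isCommutativeRing }

isZero : ∀ p → Maybe ([] ≈ p)
isZero []      = just ≈-refl
isZero (c ∷ p) with c ℤ.≟ + 0 | isZero p
... | yes c≡0 | just 0≈p = just (coeffwise λ { zero → sym c≡0 ; (suc k) → coeff-≡ 0≈p k })
... | _       | _        = nothing

ℤ[q]-almost : ACR.AlmostCommutativeRing 0ℓ 0ℓ
ℤ[q]-almost = ACR.fromCommutativeRing ℤ[q] isZero

open CommutativeRing ℤ[q] using (+-cong; +-congˡ; +-congʳ; *-cong; *-congˡ; *-congʳ; *-comm; *-assoc;
  *-identityˡ; *-identityʳ; +-identityʳ; distribˡ; zeroʳ)
open ACR.AlmostCommutativeRing ℤ[q]-almost using (_+_; _*_; -_; 0#; 1#)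
open import Algebra.Properties.CommutativeSemiring.Exp (CommutativeRing.commutativeSemiring ℤ[q])
  using (_^_; ^-congˡ; ^-homo-*; ^-distrib-*)
open import Relation.Binary.Reasoning.Setoid ≈-setoid

infixl 6 _-_
_-_ : Poly → Poly → Poly
p - q = p + - q

X : Poly
X = + 0 ∷ + 1 ∷ []

const : ℤ → Poly
const c = c ∷ []

ι : ℕ → Poly
ι n = const (+ n)

𝟙 : Bool → Poly
𝟙 true  = 1#
𝟙 false = 0#

1#^ : ∀ n → 1# ^ n ≈ 1#
1#^ zero    = ≈-refl
1#^ (suc n) = ≈-trans (*-congˡ {1#} (1#^ n)) (*-identityˡ 1#)

pPow≈^ : ∀ p n → pPow p n ≈ p ^ n
pPow≈^ p zero    = ≈-refl
pPow≈^ p (suc n) = *-congˡ {p} (pPow≈^ p n)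

X*-shift : ∀ p → X * p ≈ + 0 ∷ p
X*-shift p = ≈-trans (pMul-shiftˡ pOne p) (∷-cong refl (*-identityˡ p))

const-* : ∀ c d → const (c ℤ.* d) ≈ const c * const d
const-* c d = ∷-cong (sym (ℤₚ.+-identityʳ _)) ≈-refl

ι-* : ∀ m n → ι (m ℕ.* n) ≈ ι m * ι n
ι-* m n = ≈-trans (≈-reflexive (cong const (ℤₚ.pos-* m n))) (const-* (+ m) (+ n))

ι-^ : ∀ m s → ι (m ℕ.^ s) ≈ ι m ^ s
ι-^ m zero    = ≈-refl
ι-^ m (suc s) = ≈-trans (ι-* m (m ℕ.^ s)) (*-congˡ {ι m} (ι-^ m s))

ι-if : ∀ b n → ι (if b then n else 0) ≈ 𝟙 b * ι n
ι-if true  n = ≈-sym (*-identityˡ (ι n))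
ι-if false n = coeffwise λ { zero → refl ; (suc k) → refl }

ι-indicator : ∀ b → ι (if b then 1 else 0) ≈ 𝟙 b
ι-indicator b = ≈-trans (ι-if b 1) (*-identityʳ (𝟙 b))

𝟙-∧-swap : ∀ a b c → 𝟙 (a ∧ b) * 𝟙 c ≈ 𝟙 (a ∧ c) * 𝟙 b
𝟙-∧-swap true  b c = *-comm (𝟙 b) (𝟙 c)
𝟙-∧-swap false b c = ≈-refl

pMonomial≈const*X^ : ∀ c m → pMonomial c m ≈ const c * X ^ m
pMonomial≈const*X^ c zero    = ≈-sym (*-identityʳ (const c))
pMonomial≈const*X^ c (suc m) = begin
  + 0 ∷ pMonomial c m      ≈⟨ ∷-cong refl (pMonomial≈const*X^ c m) ⟩
  + 0 ∷ const c * X ^ m    ≈⟨ X*-shift _ ⟨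
  X * (const c * X ^ m)    ≈⟨ swap X (const c) (X ^ m) ⟩
  const c * X ^ suc m      ∎
  where
  swap : ∀ x a b → x * (a * b) ≈ a * (x * b)
  swap = solve-∀ ℤ[q]-almost

qInt-suc : ∀ k → qInt (suc k) ≈ 1# + X * qInt k
qInt-suc k = ≈-sym (+-congˡ {1#} (X*-shift (qInt k)))

geometric-sum : ∀ k → 1# - X ^ k ≈ (1# - X) * qInt k
geometric-sum zero    = ≈-trans (coeffwise λ { zero → refl ; (suc k) → refl }) (≈-sym (zeroʳ (1# - X)))
geometric-sum (suc k) = begin
  1# - X * X ^ k                      ≈⟨ split X (X ^ k) ⟩
  1# - X + X * (1# - X ^ k)           ≈⟨ +-congˡ {1# - X} (*-congˡ {X} (geometric-sum k)) ⟩
  1# - X + X * ((1# - X) * qInt k)    ≈⟨ factorise X (qInt k) ⟩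
  (1# - X) * (1# + X * qInt k)        ≈⟨ *-congˡ {1# - X} (qInt-suc k) ⟨
  (1# - X) * qInt (suc k)             ∎
  where
  split : ∀ x y → 1# - x * y ≈ 1# - x + x * (1# - y)
  split = solve-∀ ℤ[q]-almost
  factorise : ∀ x i → 1# - x + x * ((1# - x) * i) ≈ (1# - x) * (1# + x * i)
  factorise = solve-∀ ℤ[q]-almost

∑ : List A → (A → Poly) → Poly
∑ []       f = 0#
∑ (x ∷ xs) f = f x + ∑ xs f

infix 5 ∑
syntax ∑ xs (λ x → e) = ∑[ x ∈ xs ] e

∑-cong : ∀ (xs : List A) {f g : A → Poly} → (∀ x → f x ≈ g x) → ∑ xs f ≈ ∑ xs g
∑-cong []       f≈g = ≈-refl
∑-cong (x ∷ xs) f≈g = +-cong (f≈g x) (∑-cong xs f≈g)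

∑-++ : ∀ (xs ys : List A) f → ∑ (xs ++ ys) f ≈ ∑ xs f + ∑ ys f
∑-++ []       ys f = ≈-refl
∑-++ (x ∷ xs) ys f = ≈-trans (+-congˡ {f x} (∑-++ xs ys f)) (≈-sym (pAdd-assoc (f x) (∑ xs f) (∑ ys f)))

∑-0# : ∀ (xs : List A) → ∑[ x ∈ xs ] 0# ≈ 0#
∑-0# []       = ≈-refl
∑-0# (x ∷ xs) = ∑-0# xs

∑-+ : ∀ (xs : List A) f g → ∑[ x ∈ xs ] (f x + g x) ≈ ∑ xs f + ∑ xs g
∑-+ []       f g = ≈-refl
∑-+ (x ∷ xs) f g = ≈-trans (+-congˡ {f x + g x} (∑-+ xs f g))
                           (pAdd-interchange (f x) (g x) (∑ xs f) (∑ xs g))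

∑-*ˡ : ∀ (xs : List A) c f → ∑[ x ∈ xs ] (c * f x) ≈ c * ∑ xs f
∑-*ˡ []       c f = ≈-sym (zeroʳ c)
∑-*ˡ (x ∷ xs) c f = ≈-trans (+-congˡ {c * f x} (∑-*ˡ xs c f)) (≈-sym (distribˡ c (f x) (∑ xs f)))

∑-*ʳ : ∀ (xs : List A) c f → ∑[ x ∈ xs ] (f x * c) ≈ ∑ xs f * c
∑-*ʳ xs c f = ≈-trans (∑-cong xs λ x → *-comm (f x) c) (≈-trans (∑-*ˡ xs c f) (*-comm c (∑ xs f)))

∑-concatMap : ∀ (g : A → List B) (xs : List A) f → ∑ (concatMap g xs) f ≈ ∑[ x ∈ xs ] ∑ (g x) f
∑-concatMap g []       f = ≈-refl
∑-concatMap g (x ∷ xs) f = ≈-trans (∑-++ (g x) (concatMap g xs) f) (+-congˡ {∑ (g x) f} (∑-concatMap g xs f))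

∑-comm : ∀ (xs : List A) (ys : List B) (g : A → B → Poly) →
  ∑[ x ∈ xs ] ∑[ y ∈ ys ] g x y ≈ ∑[ y ∈ ys ] ∑[ x ∈ xs ] g x y
∑-comm []       ys g = ≈-sym (∑-0# ys)
∑-comm (x ∷ xs) ys g = ≈-trans (+-congˡ {∑[ y ∈ ys ] g x y} (∑-comm xs ys g)) (≈-sym (∑-+ ys (g x) _))

ι-count : ∀ (xs : List A) f → ι (count (map f xs)) ≈ ∑[ x ∈ xs ] ι (f x)
ι-count []       f = coeffwise λ { zero → refl ; (suc k) → refl }
ι-count (x ∷ xs) f = +-congˡ {ι (f x)} (ι-count xs f)

∑-𝟙-uniform : ∀ (xs : List A) (b : A → Bool) (f : A → Poly) h → (∀ x → b x ≡ true → f x ≈ h) →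
  ∑[ x ∈ xs ] 𝟙 (b x) * f x ≈ ι (count (map (λ x → if b x then 1 else 0) xs)) * h
∑-𝟙-uniform xs b f h f≈h = begin
  ∑[ x ∈ xs ] 𝟙 (b x) * f x                              ≈⟨ ∑-cong xs pointwise ⟩
  ∑[ x ∈ xs ] 𝟙 (b x) * h                                ≈⟨ ∑-*ʳ xs h (λ x → 𝟙 (b x)) ⟩
  (∑[ x ∈ xs ] 𝟙 (b x)) * h                              ≈⟨ *-congʳ {h} (∑-cong xs (λ x → ι-indicator (b x))) ⟨
  (∑[ x ∈ xs ] ι (if b x then 1 else 0)) * h             ≈⟨ *-congʳ {h} (ι-count xs _) ⟨
  ι (count (map (λ x → if b x then 1 else 0) xs)) * h    ∎
  where
  pointwise : ∀ x → 𝟙 (b x) * f x ≈ 𝟙 (b x) * h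
  pointwise x with b x in eq
  ... | true  = *-congˡ {1#} (f≈h x eq)
  ... | false = ≈-refl

∑-allBoolVecs-suc : ∀ k (F : Vec Bool (suc k) → Poly) →
  ∑ (allBoolVecs (suc k)) F ≈ ∑[ v ∈ allBoolVecs k ] (F (true ∷ᵥ v) + F (false ∷ᵥ v))
∑-allBoolVecs-suc k F = ≈-trans (∑-concatMap _ (allBoolVecs k) F)
  (∑-cong (allBoolVecs k) λ v → +-congˡ {F (true ∷ᵥ v)} (+-identityʳ (F (false ∷ᵥ v))))

∑-allBoolVecs-∷ʳ : ∀ k (F : Vec Bool (suc k) → Poly) →
  ∑ (allBoolVecs (suc k)) F ≈ ∑[ v ∈ allBoolVecs k ] (F (v ∷ʳ true) + F (v ∷ʳ false))
∑-allBoolVecs-∷ʳ zero    F = ∑-allBoolVecs-suc zero F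
∑-allBoolVecs-∷ʳ (suc k) F = begin
  ∑ (allBoolVecs (suc (suc k))) F
    ≈⟨ ∑-allBoolVecs-suc (suc k) F ⟩
  ∑[ v ∈ allBoolVecs (suc k) ] (F (true ∷ᵥ v) + F (false ∷ᵥ v))
    ≈⟨ ∑-allBoolVecs-∷ʳ k (λ v → F (true ∷ᵥ v) + F (false ∷ᵥ v)) ⟩
  ∑[ v ∈ allBoolVecs k ] (G v true true + G v false true + (G v true false + G v false false))
    ≈⟨ ∑-cong (allBoolVecs k) (λ v → pAdd-interchange (G v true true) (G v false true) (G v true false) (G v false false)) ⟩
  ∑[ v ∈ allBoolVecs k ] (G v true true + G v true false + (G v false true + G v false false))
    ≈⟨ ∑-allBoolVecs-suc k (λ v → F (v ∷ʳ true) + F (v ∷ʳ false)) ⟨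
  ∑[ v ∈ allBoolVecs (suc k) ] (F (v ∷ʳ true) + F (v ∷ʳ false)) ∎
  where
  G : Vec Bool k → Bool → Bool → Poly
  G v first last = F (first ∷ᵥ (v ∷ʳ last))

-- The Major MacMahon map

Θ-from : ℕ → NCPoly → Poly
Θ-from i []            = []
Θ-from i ((c , w) ∷ p) = pMonomial c (majFrom i w) + Θ-from i p

Θ≡Θ-from-1 : ∀ p → Θ p ≡ Θ-from 1 p
Θ≡Θ-from-1 []            = refl
Θ≡Θ-from-1 ((c , w) ∷ p) = cong (pAdd (pMonomial c (maj w))) (Θ≡Θ-from-1 p)

Θ-from-++ : ∀ i p q → Θ-from i (p ++ q) ≈ Θ-from i p + Θ-from i q
Θ-from-++ i []            q = ≈-refl
Θ-from-++ i ((c , w) ∷ p) q = ≈-trans (+-congˡ {pMonomial c (majFrom i w)} (Θ-from-++ i p q))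
                                      (≈-sym (pAdd-assoc (pMonomial c (majFrom i w)) (Θ-from i p) (Θ-from i q)))

Θ-from-concatMap : ∀ i (g : A → NCPoly) xs → Θ-from i (concatMap g xs) ≈ ∑[ x ∈ xs ] Θ-from i (g x)
Θ-from-concatMap i g []       = ≈-refl
Θ-from-concatMap i g (x ∷ xs) = ≈-trans (Θ-from-++ i (g x) (concatMap g xs)) (+-congˡ {Θ-from i (g x)} (Θ-from-concatMap i g xs))

Θ-from-ncScale : ∀ i c p → Θ-from i (ncScale c p) ≈ const c * Θ-from i p
Θ-from-ncScale i c []            = ≈-sym (zeroʳ (const c))
Θ-from-ncScale i c ((d , w) ∷ p) = begin
  pMonomial (c ℤ.* d) m + Θ-from i (ncScale c p)      ≈⟨ +-cong (pMonomial≈const*X^ (c ℤ.* d) m) (Θ-from-ncScale i c p) ⟩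
  const (c ℤ.* d) * X ^ m + const c * Θ-from i p      ≈⟨ +-congʳ {const c * Θ-from i p} (*-congʳ {X ^ m} (const-* c d)) ⟩
  const c * const d * X ^ m + const c * Θ-from i p    ≈⟨ factor-out (const c) (const d) (X ^ m) (Θ-from i p) ⟩
  const c * (const d * X ^ m + Θ-from i p)            ≈⟨ *-congˡ {const c} (+-congʳ (pMonomial≈const*X^ d m)) ⟨
  const c * Θ-from i ((d , w) ∷ p)                    ∎
  where
  m : ℕ
  m = majFrom i w
  factor-out : ∀ a b x t → a * b * x + a * t ≈ a * (b * x + t)
  factor-out = solve-∀ ℤ[q]-almost

Θ-letter : ℕ → AB → Poly
Θ-letter i 𝐚 = 1#
Θ-letter i 𝐛 = X ^ i

X^majFrom-∷ : ∀ i x w → X ^ majFrom i (x ∷ w) ≈ Θ-letter i x * X ^ majFrom (suc i) w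
X^majFrom-∷ i 𝐚 w = ≈-sym (*-identityˡ _)
X^majFrom-∷ i 𝐛 w = ^-homo-* X i (majFrom (suc i) w)

Θ-from-letter : ∀ i c x p → Θ-from i (ncMul ((c , x ∷ []) ∷ []) p) ≈ const c * Θ-letter i x * Θ-from (suc i) p
Θ-from-letter i c x []            = ≈-sym (zeroʳ (const c * Θ-letter i x))
Θ-from-letter i c x ((d , w) ∷ p) = begin
  pMonomial (c ℤ.* d) (majFrom i (x ∷ w)) + Θ-from i (ncMul ((c , x ∷ []) ∷ []) p)
    ≈⟨ +-cong (pMonomial≈const*X^ (c ℤ.* d) (majFrom i (x ∷ w))) (Θ-from-letter i c x p) ⟩
  const (c ℤ.* d) * X ^ majFrom i (x ∷ w) + a * Θ-from (suc i) p
    ≈⟨ +-congʳ {a * Θ-from (suc i) p} (*-cong (const-* c d) (X^majFrom-∷ i x w)) ⟩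
  const c * const d * (Θ-letter i x * X ^ m) + a * Θ-from (suc i) p
    ≈⟨ factor-out (const c) (const d) (Θ-letter i x) (X ^ m) (Θ-from (suc i) p) ⟩
  a * (const d * X ^ m + Θ-from (suc i) p)
    ≈⟨ *-congˡ {a} (+-congʳ (pMonomial≈const*X^ d m)) ⟨
  a * Θ-from (suc i) ((d , w) ∷ p) ∎
  where
  m : ℕ
  m = majFrom (suc i) w
  a : Poly
  a = const c * Θ-letter i x
  factor-out : ∀ c d l x t → c * d * (l * x) + c * l * t ≈ c * l * (d * x + t)
  factor-out = solve-∀ ℤ[q]-almost

ncMul-∷ : ∀ t ts p → ncMul (t ∷ ts) p ≡ ncMul (t ∷ []) p ++ ncMul ts p
ncMul-∷ t ts p = cong (_++ ncMul ts p) (sym (Listₚ.++-identityʳ _))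

Θ-from-ncMul-∷ : ∀ i t ts p → Θ-from i (ncMul (t ∷ ts) p) ≈ Θ-from i (ncMul (t ∷ []) p) + Θ-from i (ncMul ts p)
Θ-from-ncMul-∷ i t ts p rewrite ncMul-∷ t ts p = Θ-from-++ i (ncMul (t ∷ []) p) (ncMul ts p)

factor : ℕ → Bool → Poly
factor i true  = X ^ i
factor i false = 1# - X ^ i

weight : ∀ {k} → ℕ → Vec Bool k → Poly
weight i []ᵥ      = 1#
weight i (b ∷ᵥ v) = factor i b * weight (suc i) v

Θ-from-vS : ∀ {k} i (v : Vec Bool k) → Θ-from i (vS v) ≈ weight i v
Θ-from-vS i []ᵥ          = coeffwise λ { zero → refl ; (suc k) → refl }
Θ-from-vS i (true ∷ᵥ v)  = ≈-trans (Θ-from-letter i (+ 1) 𝐛 (vS v)) (*-cong (*-identityˡ (X ^ i)) (Θ-from-vS (suc i) v))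
Θ-from-vS i (false ∷ᵥ v) = begin
  Θ-from i (ncMul ((+ 1 , 𝐚 ∷ []) ∷ (ℤ.- + 1 , 𝐛 ∷ []) ∷ []) (vS v))
    ≈⟨ Θ-from-ncMul-∷ i (+ 1 , 𝐚 ∷ []) ((ℤ.- + 1 , 𝐛 ∷ []) ∷ []) (vS v) ⟩
  Θ-from i (ncMul ((+ 1 , 𝐚 ∷ []) ∷ []) (vS v)) + Θ-from i (ncMul ((ℤ.- + 1 , 𝐛 ∷ []) ∷ []) (vS v))
    ≈⟨ +-cong (Θ-from-letter i (+ 1) 𝐚 (vS v)) (Θ-from-letter i (ℤ.- + 1) 𝐛 (vS v)) ⟩
  1# * 1# * t + - 1# * X ^ i * t
    ≈⟨ collect (X ^ i) t ⟩
  (1# - X ^ i) * t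
    ≈⟨ *-congˡ {1# - X ^ i} (Θ-from-vS (suc i) v) ⟩
  weight i (false ∷ᵥ v) ∎
  where
  t : Poly
  t = Θ-from (suc i) (vS v)
  collect : ∀ x t → 1# * 1# * t + - 1# * x * t ≈ (1# - x) * t
  collect = solve-∀ ℤ[q]-almost

Θ-Ψ≈∑-flagF : ∀ n P → Θ (Ψ n P) ≈ ∑[ v ∈ allBoolVecs n ] ι (flagF P (toSet v)) * weight 1 v
Θ-Ψ≈∑-flagF n P = begin
  Θ (Ψ n P)                          ≡⟨ Θ≡Θ-from-1 (Ψ n P) ⟩
  Θ-from 1 (Ψ n P)                   ≈⟨ Θ-from-concatMap 1 _ (allBoolVecs n) ⟩
  ∑[ v ∈ allBoolVecs n ] Θ-from 1 (ncScale (+ flagF P (toSet v)) (vS v))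
    ≈⟨ ∑-cong (allBoolVecs n) (λ v → ≈-trans (Θ-from-ncScale 1 (+ flagF P (toSet v)) (vS v))
                                              (*-congˡ {ι (flagF P (toSet v))} (Θ-from-vS 1 v))) ⟩
  ∑[ v ∈ allBoolVecs n ] ι (flagF P (toSet v)) * weight 1 v ∎

setFrom-∷ʳ-true : ∀ {k} i (v : Vec Bool k) → setFrom i (v ∷ʳ true) ≡ setFrom i v ++ (i ℕ.+ k) ∷ []
setFrom-∷ʳ-true {zero}  i []ᵥ rewrite ℕₚ.+-identityʳ i = refl
setFrom-∷ʳ-true {suc k} i (true ∷ᵥ v)  rewrite ℕₚ.+-suc i k = cong (i ∷_) (setFrom-∷ʳ-true (suc i) v)
setFrom-∷ʳ-true {suc k} i (false ∷ᵥ v) rewrite ℕₚ.+-suc i k = setFrom-∷ʳ-true (suc i) v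

setFrom-∷ʳ-false : ∀ {k} i (v : Vec Bool k) → setFrom i (v ∷ʳ false) ≡ setFrom i v
setFrom-∷ʳ-false i []ᵥ          = refl
setFrom-∷ʳ-false i (true ∷ᵥ v)  = cong (i ∷_) (setFrom-∷ʳ-false (suc i) v)
setFrom-∷ʳ-false i (false ∷ᵥ v) = setFrom-∷ʳ-false (suc i) v

weight-∷ʳ : ∀ {k} i (v : Vec Bool k) b → weight i (v ∷ʳ b) ≈ weight i v * factor (i ℕ.+ k) b
weight-∷ʳ {zero}  i []ᵥ      b rewrite ℕₚ.+-identityʳ i = *-comm (factor i b) 1#
weight-∷ʳ {suc k} i (c ∷ᵥ v) b rewrite ℕₚ.+-suc i k =
  ≈-trans (*-congˡ {factor i c} (weight-∷ʳ (suc i) v b)) (≈-sym (*-assoc (factor i c) (weight (suc i) v) _))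

open FinGradedPoset

chainsTo : (P : FinGradedPoset) → Elem P → List ℕ → Elem P → ℕ
chainsTo P x []       z = if _<ᵇ_ P x z then 1 else 0
chainsTo P x (s ∷ ss) z =
  count (map (λ y → if (rank P y ≡ᵇ s) ∧ _<ᵇ_ P x y then chainsTo P y ss z else 0) (elems P))

chainsFrom≡chainsTo-top : ∀ P x ss → chainsFrom P x ss ≡ chainsTo P x ss (top P)
chainsFrom≡chainsTo-top P x []       = refl
chainsFrom≡chainsTo-top P x (s ∷ ss) = cong count (Listₚ.map-cong
  (λ y → cong (if (rank P y ≡ᵇ s) ∧ _<ᵇ_ P x y then_else 0) (chainsFrom≡chainsTo-top P y ss)) (elems P))

belowᵇ : (P : FinGradedPoset) → ℕ → Elem P → Elem P → Bool
belowᵇ P s y z = (rank P y ≡ᵇ s) ∧ _<ᵇ_ P y z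

belowᵇ-sound : ∀ P s y z → belowᵇ P s y z ≡ true → rank P y ≡ s × _<ᵇ_ P y z ≡ true
belowᵇ-sound P s y z below with rank P y ≡ᵇ s in r
... | true = ℕₚ.≡ᵇ⇒≡ (rank P y) s (Equivalence.from T-≡ r) , below

ι-chainsTo-∷ : ∀ P x s ss z →
  ι (chainsTo P x (s ∷ ss) z) ≈ ∑[ y ∈ elems P ] 𝟙 ((rank P y ≡ᵇ s) ∧ _<ᵇ_ P x y) * ι (chainsTo P y ss z)
ι-chainsTo-∷ P x s ss z = ≈-trans (ι-count (elems P) _) (∑-cong (elems P) λ y → ι-if _ (chainsTo P y ss z))

ι-chainsTo-∷ʳ : ∀ P x ss s z →
  ι (chainsTo P x (ss ++ s ∷ []) z) ≈ ∑[ y ∈ elems P ] 𝟙 (belowᵇ P s y z) * ι (chainsTo P x ss y)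
ι-chainsTo-∷ʳ P x [] s z = ≈-trans (ι-chainsTo-∷ P x s [] z) (∑-cong (elems P) swap)
  where
  swap : ∀ y → 𝟙 ((rank P y ≡ᵇ s) ∧ _<ᵇ_ P x y) * ι (chainsTo P y [] z) ≈ 𝟙 (belowᵇ P s y z) * ι (chainsTo P x [] y)
  swap y = begin
    𝟙 (r ∧ x<y) * ι (chainsTo P y [] z)      ≈⟨ *-congˡ {𝟙 (r ∧ x<y)} (ι-indicator y<z) ⟩
    𝟙 (r ∧ x<y) * 𝟙 y<z                      ≈⟨ 𝟙-∧-swap r x<y y<z ⟩
    𝟙 (r ∧ y<z) * 𝟙 x<y                      ≈⟨ *-congˡ {𝟙 (r ∧ y<z)} (ι-indicator x<y) ⟨
    𝟙 (r ∧ y<z) * ι (chainsTo P x [] y)      ∎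
    where
    r x<y y<z : Bool
    r   = rank P y ≡ᵇ s
    x<y = _<ᵇ_ P x y
    y<z = _<ᵇ_ P y z
ι-chainsTo-∷ʳ P x (t ∷ ss) s z = begin
  ι (chainsTo P x (t ∷ ss ++ s ∷ []) z)
    ≈⟨ ι-chainsTo-∷ P x t (ss ++ s ∷ []) z ⟩
  ∑[ w ∈ E ] 𝟙 (first w) * ι (chainsTo P w (ss ++ s ∷ []) z)
    ≈⟨ ∑-cong E (λ w → *-congˡ {𝟙 (first w)} (ι-chainsTo-∷ʳ P w ss s z)) ⟩
  ∑[ w ∈ E ] 𝟙 (first w) * (∑[ y ∈ E ] 𝟙 (last y) * ι (chainsTo P w ss y))
    ≈⟨ ∑-cong E (λ w → ≈-trans (≈-sym (∑-*ˡ E (𝟙 (first w)) _))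
                               (∑-cong E λ y → swap (𝟙 (first w)) (𝟙 (last y)) _)) ⟩
  ∑[ w ∈ E ] ∑[ y ∈ E ] 𝟙 (last y) * (𝟙 (first w) * ι (chainsTo P w ss y))
    ≈⟨ ∑-comm E E _ ⟩
  ∑[ y ∈ E ] ∑[ w ∈ E ] 𝟙 (last y) * (𝟙 (first w) * ι (chainsTo P w ss y))
    ≈⟨ ∑-cong E (λ y → ∑-*ˡ E (𝟙 (last y)) _) ⟩
  ∑[ y ∈ E ] 𝟙 (last y) * (∑[ w ∈ E ] 𝟙 (first w) * ι (chainsTo P w ss y))
    ≈⟨ ∑-cong E (λ y → *-congˡ {𝟙 (last y)} (ι-chainsTo-∷ P x t ss y)) ⟨
  ∑[ y ∈ E ] 𝟙 (last y) * ι (chainsTo P x (t ∷ ss) y) ∎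
  where
  E : List (Elem P)
  E = elems P
  first : Elem P → Bool
  first w = (rank P w ≡ᵇ t) ∧ _<ᵇ_ P x w
  last : Elem P → Bool
  last y = belowᵇ P s y z
  swap : ∀ a d c → a * (d * c) ≈ d * (a * c)
  swap = solve-∀ ℤ[q]-almost

flagTerm : ∀ {k} (P : FinGradedPoset) → Vec Bool k → Elem P → Poly
flagTerm P v z = ι (chainsTo P (bot P) (toSet v) z) * weight 1 v

-- H_k(z): Θ of the ab-index of the interval [0̂, z], truncated to rank sets S ⊆ {1, …, k}
ΘΨ-below : (P : FinGradedPoset) → ℕ → Elem P → Poly
ΘΨ-below P k z = ∑[ v ∈ allBoolVecs k ] flagTerm P v z

Θ-Ψ≈ΘΨ-below-top : ∀ n P → Θ (Ψ n P) ≈ ΘΨ-below P n (top P)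
Θ-Ψ≈ΘΨ-below-top n P = ≈-trans (Θ-Ψ≈∑-flagF n P) (∑-cong (allBoolVecs n) λ v →
  *-congʳ {weight 1 v} (≈-reflexive (cong ι (chainsFrom≡chainsTo-top P (bot P) (toSet v)))))

ΘΨ-below-zero : ∀ P z → _<ᵇ_ P (bot P) z ≡ true → ΘΨ-below P 0 z ≈ 1#
ΘΨ-below-zero P z bot<z rewrite bot<z = +-identityʳ (1# * 1#)

flagTerm-∷ʳ-true : ∀ P {k} (v : Vec Bool k) z →
  flagTerm P (v ∷ʳ true) z ≈ (∑[ y ∈ elems P ] 𝟙 (belowᵇ P (suc k) y z) * flagTerm P v y) * X ^ suc k
flagTerm-∷ʳ-true P {k} v z = begin
  ι (chainsTo P (bot P) (toSet (v ∷ʳ true)) z) * weight 1 (v ∷ʳ true)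
    ≡⟨ cong (λ S → ι (chainsTo P (bot P) S z) * weight 1 (v ∷ʳ true)) (setFrom-∷ʳ-true 1 v) ⟩
  ι (chainsTo P (bot P) (toSet v ++ suc k ∷ []) z) * weight 1 (v ∷ʳ true)
    ≈⟨ *-cong (ι-chainsTo-∷ʳ P (bot P) (toSet v) (suc k) z) (weight-∷ʳ 1 v true) ⟩
  (∑[ y ∈ elems P ] 𝟙 (below y) * chains y) * (weight 1 v * x)
    ≈⟨ *-assoc (∑[ y ∈ elems P ] 𝟙 (below y) * chains y) (weight 1 v) x ⟨
  (∑[ y ∈ elems P ] 𝟙 (below y) * chains y) * weight 1 v * x
    ≈⟨ *-congʳ {x} (∑-*ʳ (elems P) (weight 1 v) (λ y → 𝟙 (below y) * chains y)) ⟨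
  (∑[ y ∈ elems P ] 𝟙 (below y) * chains y * weight 1 v) * x
    ≈⟨ *-congʳ {x} (∑-cong (elems P) λ y → *-assoc (𝟙 (below y)) (chains y) (weight 1 v)) ⟩
  (∑[ y ∈ elems P ] 𝟙 (below y) * flagTerm P v y) * x ∎
  where
  x : Poly
  x = X ^ suc k
  below : Elem P → Bool
  below y = belowᵇ P (suc k) y z
  chains : Elem P → Poly
  chains y = ι (chainsTo P (bot P) (toSet v) y)

flagTerm-∷ʳ-false : ∀ P {k} (v : Vec Bool k) z → flagTerm P (v ∷ʳ false) z ≈ flagTerm P v z * (1# - X ^ suc k)
flagTerm-∷ʳ-false P {k} v z = begin
  ι (chainsTo P (bot P) (toSet (v ∷ʳ false)) z) * weight 1 (v ∷ʳ false)
    ≡⟨ cong (λ S → ι (chainsTo P (bot P) S z) * weight 1 (v ∷ʳ false)) (setFrom-∷ʳ-false 1 v) ⟩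
  c * weight 1 (v ∷ʳ false)         ≈⟨ *-congˡ {c} (weight-∷ʳ 1 v false) ⟩
  c * (weight 1 v * (1# - X ^ suc k)) ≈⟨ *-assoc c (weight 1 v) (1# - X ^ suc k) ⟨
  flagTerm P v z * (1# - X ^ suc k)   ∎
  where
  c : Poly
  c = ι (chainsTo P (bot P) (toSet v) z)

ΘΨ-below-suc : ∀ P k z → ΘΨ-below P (suc k) z ≈
  (∑[ y ∈ elems P ] 𝟙 (belowᵇ P (suc k) y z) * ΘΨ-below P k y) * X ^ suc k + ΘΨ-below P k z * (1# - X ^ suc k)
ΘΨ-below-suc P k z = begin
  ΘΨ-below P (suc k) z
    ≈⟨ ∑-allBoolVecs-∷ʳ k (λ v → flagTerm P v z) ⟩
  ∑[ v ∈ V ] (flagTerm P (v ∷ʳ true) z + flagTerm P (v ∷ʳ false) z)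
    ≈⟨ ∑-cong V (λ v → +-cong (flagTerm-∷ʳ-true P v z) (flagTerm-∷ʳ-false P v z)) ⟩
  ∑[ v ∈ V ] ((∑[ y ∈ E ] 𝟙 (below y) * flagTerm P v y) * x + flagTerm P v z * (1# - x))
    ≈⟨ ∑-+ V (λ v → (∑[ y ∈ E ] 𝟙 (below y) * flagTerm P v y) * x) (λ v → flagTerm P v z * (1# - x)) ⟩
  (∑[ v ∈ V ] (∑[ y ∈ E ] 𝟙 (below y) * flagTerm P v y) * x) + (∑[ v ∈ V ] flagTerm P v z * (1# - x))
    ≈⟨ +-cong (∑-*ʳ V x _) (∑-*ʳ V (1# - x) _) ⟩
  (∑[ v ∈ V ] ∑[ y ∈ E ] 𝟙 (below y) * flagTerm P v y) * x + ΘΨ-below P k z * (1# - x)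
    ≈⟨ +-congʳ {ΘΨ-below P k z * (1# - x)} (*-congʳ {x} (∑-comm V E _)) ⟩
  (∑[ y ∈ E ] ∑[ v ∈ V ] 𝟙 (below y) * flagTerm P v y) * x + ΘΨ-below P k z * (1# - x)
    ≈⟨ +-congʳ {ΘΨ-below P k z * (1# - x)}
               (*-congʳ {x} (∑-cong E λ y → ∑-*ˡ V (𝟙 (below y)) (λ v → flagTerm P v y))) ⟩
  (∑[ y ∈ E ] 𝟙 (below y) * ΘΨ-below P k y) * x + ΘΨ-below P k z * (1# - x) ∎
  where
  E : List (Elem P)
  E = elems P
  V : List (Vec Bool k)
  V = allBoolVecs k
  x : Poly
  x = X ^ suc k
  below : Elem P → Bool
  below y = belowᵇ P (suc k) y z

countBelow : (P : FinGradedPoset) → ℕ → Elem P → ℕ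
countBelow P s z = count (map (λ y → if belowᵇ P s y z then 1 else 0) (elems P))

-- Φ a k = (1 − q)^k + Σ_{1 ≤ j ≤ k} a j (1 − q)^(k − j)
Φ : (ℕ → Poly) → ℕ → Poly
Φ a zero    = 1#
Φ a (suc k) = (1# - X) * Φ a k + a (suc k)

ΘΨ-below-Φ-step : ∀ P k z (a : ℕ → Poly) →
  ΘΨ-below P k z ≈ qFact k * Φ a k →
  (∀ y → belowᵇ P (suc k) y z ≡ true → ΘΨ-below P k y ≈ qFact (suc k)) →
  ι (countBelow P (suc k) z) * X ^ suc k ≈ a (suc k) →
  ΘΨ-below P (suc k) z ≈ qFact (suc k) * Φ a (suc k)
ΘΨ-below-Φ-step P k z a below-z below-y count≈ = begin
  ΘΨ-below P (suc k) z
    ≈⟨ ΘΨ-below-suc P k z ⟩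
  (∑[ y ∈ elems P ] 𝟙 (belowᵇ P (suc k) y z) * ΘΨ-below P k y) * x + ΘΨ-below P k z * (1# - x)
    ≈⟨ +-cong (*-congʳ {x} (∑-𝟙-uniform (elems P) (λ y → belowᵇ P (suc k) y z) _ _ below-y))
              (*-cong below-z (geometric-sum (suc k))) ⟩
  n * qFact (suc k) * x + qFact k * Φ a k * ((1# - X) * qInt (suc k))
    ≈⟨ factor-out n (qInt (suc k)) (qFact k) x (1# - X) (Φ a k) ⟩
  qFact (suc k) * ((1# - X) * Φ a k + n * x)
    ≈⟨ *-congˡ {qFact (suc k)} (+-congˡ {(1# - X) * Φ a k} count≈) ⟩
  qFact (suc k) * Φ a (suc k) ∎
  where
  x : Poly
  x = X ^ suc k
  n : Poly
  n = ι (countBelow P (suc k) z)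
  factor-out : ∀ n i f x u φ → n * (i * f) * x + f * φ * (u * i) ≈ i * f * (u * φ + n * x)
  factor-out = solve-∀ ℤ[q]-almost

binomialTerm : Poly → ℕ → ℕ → Poly
binomialTerm c t s = ι (t C s) * c ^ s

ι-pascal : ∀ t s → ι (suc t C suc s) ≈ ι (t C s) + ι (t C suc s)
ι-pascal t s = ≈-reflexive (cong ι (sym (nCk+nC[k+1]≡[n+1]C[k+1] t s)))

Φ-binomialTerm-pascal : ∀ c t k →
  Φ (binomialTerm c (suc t)) (suc k) ≈ Φ (binomialTerm c t) (suc k) + c * Φ (binomialTerm c t) k
Φ-binomialTerm-pascal c t zero = begin
  (1# - X) * 1# + ι (suc t C 1) * (c * 1#)                ≈⟨ +-congˡ {(1# - X) * 1#} (*-congʳ {c * 1#} (ι-pascal t 0)) ⟩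
  (1# - X) * 1# + (1# + ι (t C 1)) * (c * 1#)             ≈⟨ regroup (1# - X) (ι (t C 1)) c ⟩
  (1# - X) * 1# + ι (t C 1) * (c * 1#) + c * 1#           ∎
  where
  regroup : ∀ u b c → u * 1# + (1# + b) * (c * 1#) ≈ u * 1# + b * (c * 1#) + c * 1#
  regroup = solve-∀ ℤ[q]-almost
Φ-binomialTerm-pascal c t (suc k) = begin
  u * Φ (binomialTerm c (suc t)) (suc k) + ι (suc t C suc (suc k)) * c ^ suc (suc k)
    ≈⟨ +-cong (*-congˡ {u} (Φ-binomialTerm-pascal c t k)) (*-congʳ {c ^ suc (suc k)} (ι-pascal t (suc k))) ⟩
  u * (Φ (binomialTerm c t) (suc k) + c * Φ (binomialTerm c t) k) + (a + b) * c ^ suc (suc k)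
    ≈⟨ regroup u (Φ (binomialTerm c t) k) c a b (c ^ k) ⟩
  u * Φ (binomialTerm c t) (suc k) + b * c ^ suc (suc k) + c * Φ (binomialTerm c t) (suc k) ∎
  where
  u : Poly
  u = 1# - X
  a : Poly
  a = ι (t C suc k)
  b : Poly
  b = ι (t C suc (suc k))
  regroup : ∀ u f c a b p → u * (u * f + a * (c * p) + c * f) + (a + b) * (c * (c * p))
                        ≈ u * (u * f + a * (c * p)) + b * (c * (c * p)) + c * (u * f + a * (c * p))
  regroup = solve-∀ ℤ[q]-almost

Φ-binomialTerm-diagonal : ∀ c t → Φ (binomialTerm c t) t ≈ (1# - X + c) ^ t
Φ-binomialTerm-diagonal c zero    = ≈-refl
Φ-binomialTerm-diagonal c (suc t) = begin
  Φ (binomialTerm c (suc t)) (suc t)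
    ≈⟨ Φ-binomialTerm-pascal c t t ⟩
  (1# - X) * Φ (binomialTerm c t) t + ι (t C suc t) * c ^ suc t + c * Φ (binomialTerm c t) t
    ≈⟨ +-congʳ {c * Φ (binomialTerm c t) t} (+-congˡ {(1# - X) * Φ (binomialTerm c t) t}
         (*-congʳ {c ^ suc t} (≈-trans (≈-reflexive (cong ι (k>n⇒nCk≡0 (ℕₚ.n<1+n t)))) ι0≈0#))) ⟩
  (1# - X) * Φ (binomialTerm c t) t + 0# * c ^ suc t + c * Φ (binomialTerm c t) t
    ≈⟨ collect (1# - X) c (Φ (binomialTerm c t) t) (c ^ suc t) ⟩
  (1# - X + c) * Φ (binomialTerm c t) t
    ≈⟨ *-congˡ {1# - X + c} (Φ-binomialTerm-diagonal c t) ⟩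
  (1# - X + c) ^ suc t ∎
  where
  ι0≈0# : ι 0 ≈ 0#
  ι0≈0# = coeffwise λ { zero → refl ; (suc k) → refl }
  collect : ∀ u c f w → u * f + 0# * w + c * f ≈ (u + c) * f
  collect = solve-∀ ℤ[q]-almost

Φ-binomialTerm-X : ∀ k → Φ (binomialTerm X (suc k)) k ≈ qInt (suc k)
Φ-binomialTerm-X zero    = ≈-refl
Φ-binomialTerm-X (suc k) = begin
  Φ (binomialTerm X (suc (suc k))) (suc k)
    ≈⟨ Φ-binomialTerm-pascal X (suc k) k ⟩
  Φ (binomialTerm X (suc k)) (suc k) + X * Φ (binomialTerm X (suc k)) k
    ≈⟨ +-cong (≈-trans (Φ-binomialTerm-diagonal X (suc k)) (≈-trans (^-congˡ (suc k) (cancel X)) (1#^ (suc k))))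
              (*-congˡ {X} (Φ-binomialTerm-X k)) ⟩
  1# + X * qInt (suc k)
    ≈⟨ qInt-suc (suc k) ⟨
  qInt (suc (suc k)) ∎
  where
  cancel : ∀ x → 1# - x + x ≈ 1#
  cancel = solve-∀ ℤ[q]-almost

-- Boolean lower intervals

-- A down-closed set of elements whose lower intervals have the rank sizes of Boolean lattices
-- (in a face lattice: the faces that are simplices).
record BooleanIdeal (P : FinGradedPoset) : Set₁ where
  field
    IsBoolean   : Elem P → Set
    down-closed : ∀ {y z} → IsBoolean z → _<ᵇ_ P y z ≡ true → IsBoolean y
    bot<        : ∀ {z} → IsBoolean z → 1 ≤ rank P z → _<ᵇ_ P (bot P) z ≡ true
    countBelow≡ : ∀ {s z} → IsBoolean z → s < rank P z → countBelow P s z ≡ rank P z C s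

open BooleanIdeal

mutual
  ΘΨ-below-boolean : ∀ {P} (B : BooleanIdeal P) k {z} → IsBoolean B z → k < rank P z →
    ΘΨ-below P k z ≈ qFact k * Φ (binomialTerm X (rank P z)) k
  ΘΨ-below-boolean {P} B zero    {z} b 0<r = ΘΨ-below-zero P z (bot< B b 0<r)
  ΘΨ-below-boolean {P} B (suc k) {z} b k<r = ΘΨ-below-Φ-step P k z (binomialTerm X (rank P z))
    (ΘΨ-below-boolean B k b (ℕₚ.<⇒≤ k<r))
    (λ y below → let rank≡ , y<z = belowᵇ-sound P (suc k) y z below in ΘΨ-boolean-interval B (down-closed B b y<z) rank≡)
    (*-congʳ {X ^ suc k} (≈-reflexive (cong ι (countBelow≡ B b k<r))))

  ΘΨ-boolean-interval : ∀ {P} (B : BooleanIdeal P) {k z} → IsBoolean B z → rank P z ≡ suc k → ΘΨ-below P k z ≈ qFact (suc k)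
  ΘΨ-boolean-interval {P} B {k} {z} b rank≡ = begin
    ΘΨ-below P k z                                  ≈⟨ ΘΨ-below-boolean B k b (ℕₚ.≤-reflexive (sym rank≡)) ⟩
    qFact k * Φ (binomialTerm X (rank P z)) k        ≡⟨ cong (λ t → qFact k * Φ (binomialTerm X t) k) rank≡ ⟩
    qFact k * Φ (binomialTerm X (suc k)) k           ≈⟨ *-congˡ {qFact k} (Φ-binomialTerm-X k) ⟩
    qFact k * qInt (suc k)                           ≈⟨ *-comm (qFact k) (qInt (suc k)) ⟩
    qFact (suc k)                                    ∎

count-map-cong : ∀ (xs : List A) {f g : A → ℕ} → (∀ x → f x ≡ g x) → count (map f xs) ≡ count (map g xs)
count-map-cong xs f≗g = cong count (Listₚ.map-cong f≗g xs)

count-map-zero : ∀ (xs : List A) {f : A → ℕ} → (∀ x → f x ≡ 0) → count (map f xs) ≡ 0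
count-map-zero []       f≗0 = refl
count-map-zero (x ∷ xs) f≗0 = cong₂ ℕ._+_ (f≗0 x) (count-map-zero xs f≗0)

count-∧-false : ∀ (xs : List A) (b : A → Bool) → count (map (λ x → if b x ∧ false then 1 else 0) xs) ≡ 0
count-∧-false xs b = count-map-zero xs λ x → cong (λ c → if c then 1 else 0) (∧-zeroʳ (b x))

count-map-+ : ∀ (xs : List A) f g → count (map (λ x → f x ℕ.+ g x) xs) ≡ count (map f xs) ℕ.+ count (map g xs)
count-map-+ []       f g = refl
count-map-+ (x ∷ xs) f g =
  trans (cong (f x ℕ.+ g x ℕ.+_) (count-map-+ xs f g)) (+-interchange (f x) (g x) (count (map f xs)) (count (map g xs)))

count-map-concatMap : ∀ (g : A → List B) xs f → count (map f (concatMap g xs)) ≡ count (map (λ x → count (map f (g x))) xs)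
count-map-concatMap g []       f = refl
count-map-concatMap g (x ∷ xs) f = trans (cong count (Listₚ.map-++ f (g x) (concatMap g xs)))
  (trans (sum-++ (map f (g x)) _) (cong (count (map f (g x)) ℕ.+_) (count-map-concatMap g xs f)))

count-allBoolVecs-suc : ∀ m (f : Vec Bool (suc m) → ℕ) → count (map f (allBoolVecs (suc m))) ≡
  count (map (λ v → f (true ∷ᵥ v)) (allBoolVecs m)) ℕ.+ count (map (λ v → f (false ∷ᵥ v)) (allBoolVecs m))
count-allBoolVecs-suc m f = trans (count-map-concatMap _ (allBoolVecs m) f)
  (trans (count-map-cong (allBoolVecs m) λ v → cong (f (true ∷ᵥ v) ℕ.+_) (ℕₚ.+-identityʳ (f (false ∷ᵥ v))))
         (count-map-+ (allBoolVecs m) _ _))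

count-allSignVecs-suc : ∀ m (f : Vec Sign (suc m) → ℕ) → count (map f (allSignVecs (suc m))) ≡
  count (map (λ v → f (s0 ∷ᵥ v)) (allSignVecs m))
    ℕ.+ (count (map (λ v → f (s+ ∷ᵥ v)) (allSignVecs m)) ℕ.+ count (map (λ v → f (s- ∷ᵥ v)) (allSignVecs m)))
count-allSignVecs-suc m f = trans (count-map-concatMap _ (allSignVecs m) f)
  (trans (count-map-cong (allSignVecs m) λ v →
           cong (λ n → f (s0 ∷ᵥ v) ℕ.+ (f (s+ ∷ᵥ v) ℕ.+ n)) (ℕₚ.+-identityʳ (f (s- ∷ᵥ v))))
  (trans (count-map-+ (allSignVecs m) _ _)
         (cong (count (map (λ v → f (s0 ∷ᵥ v)) (allSignVecs m)) ℕ.+_) (count-map-+ (allSignVecs m) _ _))))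

drop-≢-below-rank : ∀ (r : A → ℕ) (le eq : A → Bool) {s t} → s < t → (∀ y → eq y ≡ true → r y ≡ t) →
  ∀ y → (r y ≡ᵇ s) ∧ (le y ∧ not (eq y)) ≡ (r y ≡ᵇ s) ∧ le y
drop-≢-below-rank r le eq {s} {t} s<t eq⇒t y with r y ≡ᵇ s in rank≡ | eq y in e
... | false | _     = refl
... | true  | false = ∧-identityʳ (le y)
... | true  | true  =
  ⊥-elim (ℕₚ.<-irrefl (trans (sym (ℕₚ.≡ᵇ⇒≡ (r y) s (Equivalence.from T-≡ rank≡))) (eq⇒t y e)) s<t)

-- The simplex

countTrue-eqBoolVec : ∀ {m} (y z : Vec Bool m) → eqBoolVec y z ≡ true → countTrue y ≡ countTrue z
countTrue-eqBoolVec []ᵥ          []ᵥ          _  = refl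
countTrue-eqBoolVec (true ∷ᵥ y)  (true ∷ᵥ z)  eq = cong suc (countTrue-eqBoolVec y z eq)
countTrue-eqBoolVec (false ∷ᵥ y) (false ∷ᵥ z) eq = countTrue-eqBoolVec y z eq
countTrue-eqBoolVec (true ∷ᵥ y)  (false ∷ᵥ z) ()
countTrue-eqBoolVec (false ∷ᵥ y) (true ∷ᵥ z)  ()

count-subsets : ∀ {m} (z : Vec Bool m) s →
  count (map (λ y → if (countTrue y ≡ᵇ s) ∧ subsetᵇ y z then 1 else 0) (allBoolVecs m)) ≡ countTrue z C s
count-subsets []ᵥ zero    = refl
count-subsets []ᵥ (suc s) = refl
count-subsets {suc m} (true ∷ᵥ z) zero = trans (count-allBoolVecs-suc m _)
  (cong₂ ℕ._+_ (count-map-zero (allBoolVecs m) λ _ → refl) (count-subsets z zero))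
count-subsets {suc m} (true ∷ᵥ z) (suc s) = trans (count-allBoolVecs-suc m _)
  (trans (cong₂ ℕ._+_ (count-subsets z s) (count-subsets z (suc s))) (nCk+nC[k+1]≡[n+1]C[k+1] (countTrue z) s))
count-subsets {suc m} (false ∷ᵥ z) s = trans (count-allBoolVecs-suc m _)
  (cong₂ ℕ._+_ (count-∧-false (allBoolVecs m) λ y → suc (countTrue y) ≡ᵇ s) (count-subsets z s))

subsetᵇ-empty : ∀ {m} (z : Vec Bool m) → subsetᵇ (constVec false) z ≡ true
subsetᵇ-empty []ᵥ      = refl
subsetᵇ-empty (_ ∷ᵥ z) = subsetᵇ-empty z

eqBoolVec-empty : ∀ {m} (z : Vec Bool m) → 1 ≤ countTrue z → eqBoolVec (constVec false) z ≡ false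
eqBoolVec-empty (true ∷ᵥ z)  _   = refl
eqBoolVec-empty (false ∷ᵥ z) 1≤z = eqBoolVec-empty z 1≤z

countTrue-full : ∀ m → countTrue (constVec {m} true) ≡ m
countTrue-full zero    = refl
countTrue-full (suc m) = cong suc (countTrue-full m)

simplex-booleanIdeal : ∀ n → BooleanIdeal (simplexFaceLattice n)
simplex-booleanIdeal n = record
  { IsBoolean   = λ _ → ⊤
  ; down-closed = λ _ _ → tt
  ; bot<        = λ {z} _ 1≤z → cong₂ (λ a b → a ∧ not b) (subsetᵇ-empty z) (eqBoolVec-empty z 1≤z)
  ; countBelow≡ = λ {s} {z} _ s<z → trans
      (count-map-cong (allBoolVecs (suc n)) λ y → cong (λ c → if c then 1 else 0)
        (drop-≢-below-rank countTrue (λ y → subsetᵇ y z) (λ y → eqBoolVec y z) s<z (λ y → countTrue-eqBoolVec y z) y))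
      (count-subsets z s)
  }

Θ-Ψ-simplex : ∀ n → Θ (Ψ n (simplexFaceLattice n)) ≈ qFact (suc n)
Θ-Ψ-simplex n = ≈-trans (Θ-Ψ≈ΘΨ-below-top n (simplexFaceLattice n))
                        (ΘΨ-boolean-interval (simplex-booleanIdeal n) tt (countTrue-full (suc n)))

-- The cross-polytope

support-signVecEqᵇ : ∀ {m} (w u : Vec Sign m) → signVecEqᵇ w u ≡ true → support w ≡ support u
support-signVecEqᵇ []ᵥ        []ᵥ        _  = refl
support-signVecEqᵇ (s0 ∷ᵥ w) (s0 ∷ᵥ u) eq = support-signVecEqᵇ w u eq
support-signVecEqᵇ (s+ ∷ᵥ w) (s+ ∷ᵥ u) eq = cong suc (support-signVecEqᵇ w u eq)
support-signVecEqᵇ (s- ∷ᵥ w) (s- ∷ᵥ u) eq = cong suc (support-signVecEqᵇ w u eq)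
support-signVecEqᵇ (s0 ∷ᵥ w) (s+ ∷ᵥ u) ()
support-signVecEqᵇ (s0 ∷ᵥ w) (s- ∷ᵥ u) ()
support-signVecEqᵇ (s+ ∷ᵥ w) (s0 ∷ᵥ u) ()
support-signVecEqᵇ (s+ ∷ᵥ w) (s- ∷ᵥ u) ()
support-signVecEqᵇ (s- ∷ᵥ w) (s0 ∷ᵥ u) ()
support-signVecEqᵇ (s- ∷ᵥ w) (s+ ∷ᵥ u) ()

count-signed-subvectors : ∀ {m} (u : Vec Sign m) s →
  count (map (λ w → if (support w ≡ᵇ s) ∧ signVecLeᵇ w u then 1 else 0) (allSignVecs m)) ≡ support u C s
count-signed-subvectors []ᵥ zero    = refl
count-signed-subvectors []ᵥ (suc s) = refl
count-signed-subvectors {suc m} (s0 ∷ᵥ u) s = trans (count-allSignVecs-suc m _)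
  (trans (cong₂ ℕ._+_ (count-signed-subvectors u s) (cong₂ ℕ._+_ (count-∧-false V supp+1≡ᵇ) (count-∧-false V supp+1≡ᵇ)))
         (ℕₚ.+-identityʳ _))
  where
  V : List (Vec Sign m)
  V = allSignVecs m
  supp+1≡ᵇ : Vec Sign m → Bool
  supp+1≡ᵇ w = suc (support w) ≡ᵇ s
count-signed-subvectors {suc m} (s+ ∷ᵥ u) zero = trans (count-allSignVecs-suc m _)
  (cong₂ ℕ._+_ (count-signed-subvectors u zero) (cong₂ ℕ._+_ (count-map-zero V λ _ → refl) (count-map-zero V λ _ → refl)))
  where
  V : List (Vec Sign m)
  V = allSignVecs m
count-signed-subvectors {suc m} (s+ ∷ᵥ u) (suc s) = trans (count-allSignVecs-suc m _)
  (trans (cong₂ ℕ._+_ (count-signed-subvectors u (suc s))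
                      (cong₂ ℕ._+_ (count-signed-subvectors u s) (count-∧-false (allSignVecs m) λ w → support w ≡ᵇ s)))
  (trans (cong (support u C suc s ℕ.+_) (ℕₚ.+-identityʳ _))
  (trans (ℕₚ.+-comm (support u C suc s) _) (nCk+nC[k+1]≡[n+1]C[k+1] (support u) s))))
count-signed-subvectors {suc m} (s- ∷ᵥ u) zero = trans (count-allSignVecs-suc m _)
  (cong₂ ℕ._+_ (count-signed-subvectors u zero) (cong₂ ℕ._+_ (count-map-zero V λ _ → refl) (count-map-zero V λ _ → refl)))
  where
  V : List (Vec Sign m)
  V = allSignVecs m
count-signed-subvectors {suc m} (s- ∷ᵥ u) (suc s) = trans (count-allSignVecs-suc m _)
  (trans (cong₂ ℕ._+_ (count-signed-subvectors u (suc s))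
                      (cong₂ ℕ._+_ (count-∧-false (allSignVecs m) λ w → support w ≡ᵇ s) (count-signed-subvectors u s)))
  (trans (ℕₚ.+-comm (support u C suc s) _) (nCk+nC[k+1]≡[n+1]C[k+1] (support u) s)))

count-signVecs-support : ∀ m s → count (map (λ w → if support w ≡ᵇ s then 1 else 0) (allSignVecs m)) ≡ 2 ℕ.^ s ℕ.* (m C s)
count-signVecs-support zero    zero    = refl
count-signVecs-support zero    (suc s) = sym (ℕₚ.*-zeroʳ (2 ℕ.^ suc s))
count-signVecs-support (suc m) zero    = trans (count-allSignVecs-suc m _)
  (cong₂ ℕ._+_ (count-signVecs-support m zero) (cong₂ ℕ._+_ (count-map-zero V λ _ → refl) (count-map-zero V λ _ → refl)))
  where
  V : List (Vec Sign m)
  V = allSignVecs m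
count-signVecs-support (suc m) (suc s) = trans (count-allSignVecs-suc m _)
  (trans (cong₂ ℕ._+_ (count-signVecs-support m (suc s)) (cong₂ ℕ._+_ (count-signVecs-support m s) (count-signVecs-support m s)))
  (trans (factor-out (2 ℕ.^ s) (m C s) (m C suc s)) (cong (2 ℕ.^ suc s ℕ.*_) (nCk+nC[k+1]≡[n+1]C[k+1] m s))))
  where
  factor-out : ∀ p a b → 2 ℕ.* p ℕ.* b ℕ.+ (p ℕ.* a ℕ.+ p ℕ.* a) ≡ 2 ℕ.* p ℕ.* (a ℕ.+ b)
  factor-out = ℕ-Solver.solve-∀

signVecLeᵇ-zeroSigns : ∀ {m} (u : Vec Sign m) → signVecLeᵇ zeroSigns u ≡ true
signVecLeᵇ-zeroSigns []ᵥ      = refl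
signVecLeᵇ-zeroSigns (_ ∷ᵥ u) = signVecLeᵇ-zeroSigns u

signVecEqᵇ-zeroSigns : ∀ {m} (u : Vec Sign m) → 1 ≤ support u → signVecEqᵇ zeroSigns u ≡ false
signVecEqᵇ-zeroSigns (s0 ∷ᵥ u) 1≤u = signVecEqᵇ-zeroSigns u 1≤u
signVecEqᵇ-zeroSigns (s+ ∷ᵥ u) _   = refl
signVecEqᵇ-zeroSigns (s- ∷ᵥ u) _   = refl

countBelow-cross : ∀ n s z → countBelow (crossFaceLattice n) s z ≡
  count (map (λ w → if belowᵇ (crossFaceLattice n) s (just w) z then 1 else 0) (allSignVecs n))
countBelow-cross n s z = cong₂ ℕ._+_ (cong (λ c → if c then 1 else 0) (∧-zeroʳ (suc n ≡ᵇ s)))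
                                     (cong count (sym (Listₚ.map-∘ (allSignVecs n))))

cross-booleanIdeal : ∀ n → BooleanIdeal (crossFaceLattice n)
cross-booleanIdeal n = record
  { IsBoolean   = λ z → T (is-just z)
  ; down-closed = just-down-closed
  ; bot<        = λ { {just u} _ 1≤u → cong₂ (λ a b → a ∧ not b) (signVecLeᵇ-zeroSigns u) (signVecEqᵇ-zeroSigns u 1≤u) }
  ; countBelow≡ = λ { {s} {just u} _ s<u → trans (countBelow-cross n s (just u))
      (trans (count-map-cong (allSignVecs n) λ w → cong (λ c → if c then 1 else 0)
               (drop-≢-below-rank support (λ w → signVecLeᵇ w u) (λ w → signVecEqᵇ w u) s<u
                                  (λ w → support-signVecEqᵇ w u) w))
             (count-signed-subvectors u s)) }
  }
  where
  just-down-closed : ∀ {y z} → T (is-just z) → crossLtᵇ y z ≡ true → T (is-just y)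
  just-down-closed {just _}  _ _  = tt
  just-down-closed {nothing} _ ()

countBelow-cross-top : ∀ n s → countBelow (crossFaceLattice n) s nothing ≡ 2 ℕ.^ s ℕ.* (n C s)
countBelow-cross-top n s = trans (countBelow-cross n s nothing)
  (trans (count-map-cong (allSignVecs n) λ w → cong (λ c → if c then 1 else 0) (∧-identityʳ (support w ≡ᵇ s)))
         (count-signVecs-support n s))

ι-countBelow-cross-top : ∀ n s → ι (countBelow (crossFaceLattice n) s nothing) * X ^ s ≈ binomialTerm (ι 2 * X) n s
ι-countBelow-cross-top n s = begin
  ι (countBelow (crossFaceLattice n) s nothing) * X ^ s   ≡⟨ cong (λ c → ι c * X ^ s) (countBelow-cross-top n s) ⟩
  ι (2 ℕ.^ s ℕ.* (n C s)) * X ^ s                         ≈⟨ *-congʳ {X ^ s} (ι-* (2 ℕ.^ s) (n C s)) ⟩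
  ι (2 ℕ.^ s) * ι (n C s) * X ^ s                         ≈⟨ *-congʳ {X ^ s} (*-congʳ {ι (n C s)} (ι-^ 2 s)) ⟩
  ι 2 ^ s * ι (n C s) * X ^ s                             ≈⟨ swap (ι 2 ^ s) (ι (n C s)) (X ^ s) ⟩
  ι (n C s) * (ι 2 ^ s * X ^ s)                           ≈⟨ *-congˡ {ι (n C s)} (^-distrib-* (ι 2) X s) ⟨
  ι (n C s) * (ι 2 * X) ^ s                               ∎
  where
  swap : ∀ a b x → a * b * x ≈ b * (a * x)
  swap = solve-∀ ℤ[q]-almost

ΘΨ-below-cross-top : ∀ n k → ΘΨ-below (crossFaceLattice n) k nothing ≈ qFact k * Φ (binomialTerm (ι 2 * X) n) k
ΘΨ-below-cross-top n zero    = ΘΨ-below-zero (crossFaceLattice n) nothing refl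
ΘΨ-below-cross-top n (suc k) = ΘΨ-below-Φ-step Cx k nothing (binomialTerm (ι 2 * X) n)
  (ΘΨ-below-cross-top n k)
  (λ y below → let rank≡ , y<top = belowᵇ-sound Cx (suc k) y nothing below in
               ΘΨ-boolean-interval (cross-booleanIdeal n) (proper y y<top) rank≡)
  (ι-countBelow-cross-top n (suc k))
  where
  Cx : FinGradedPoset
  Cx = crossFaceLattice n
  proper : ∀ y → crossLtᵇ y nothing ≡ true → T (is-just y)
  proper (just _) _ = tt
  proper nothing  ()

Θ-Ψ-cross : ∀ n → Θ (Ψ n (crossFaceLattice n)) ≈ pPow (qInt 2) n * qFact n
Θ-Ψ-cross n = begin
  Θ (Ψ n (crossFaceLattice n))                    ≈⟨ Θ-Ψ≈ΘΨ-below-top n (crossFaceLattice n) ⟩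
  ΘΨ-below (crossFaceLattice n) n nothing         ≈⟨ ΘΨ-below-cross-top n n ⟩
  qFact n * Φ (binomialTerm (ι 2 * X) n) n        ≈⟨ *-congˡ {qFact n} (Φ-binomialTerm-diagonal (ι 2 * X) n) ⟩
  qFact n * (1# - X + ι 2 * X) ^ n                ≈⟨ *-comm (qFact n) _ ⟩
  (1# - X + ι 2 * X) ^ n * qFact n                ≡⟨⟩
  qInt 2 ^ n * qFact n                            ≈⟨ *-congʳ {qFact n} (pPow≈^ (qInt 2) n) ⟨
  pPow (qInt 2) n * qFact n                       ∎

mainTheorem2 : (n : ℕ) →
    ((k : ℕ) → coeff (Θ (Ψ n (simplexFaceLattice n))) k ≡ coeff (qFact (suc n)) k)
    × ((k : ℕ) → coeff (Θ (Ψ n (crossFaceLattice n))) k ≡ coeff (pMul (pPow (qInt 2) n) (qFact n)) k)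
mainTheorem2 n = coeff-≡ (Θ-Ψ-simplex n) , coeff-≡ (Θ-Ψ-cross n)
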